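{- We have the group inclusion $L_n\unlhd M_n$ and $[M_n:L_n]=2$.
   Context: Let $\mathcal{T}$ be the rooted $3$-ary tree whose vertices are words over $X=\{0,1,2\}$, and $\mathcal{T}_n$ its truncation at level $n$. Via sections, $\mathrm{Aut}(\mathcal{T}_n)\cong(\mathrm{Aut}(\mathcal{T}_{n-1})\times\mathrm{Aut}(\mathcal{T}_{n-1})\times\mathrm{Aut}(\mathcal{T}_{n-1}))\rtimes S_3$, and an element is written $(\sigma_0,\sigma_1,\sigma_2)\pi$ with $\sigma_i\in\mathrm{Aut}(\mathcal{T}_{n-1})$ (the section at vertex $i$) and $\pi\in S_3$ (action on the first level). $\mathrm{Aut}(\mathcal{T}_{n-1})$ is embedded in $\mathrm{Aut}(\mathcal{T}_n)$ by $\sigma\mapsto(\sigma,\mathrm{id},\mathrm{id})$. Define elements recursively by $x_1=(0,1,2)$, $y_1=(0,1)$, $z_1=\mathrm{id}$ in $S_3=\mathrm{Aut}(\mathcal{T}_1)$, and for $n\ge 2$: $x_n=(\mathrm{id},\mathrm{id},x_{n-1})(0,1,2)$, $y_n=(\mathrm{id},y_{n-1},x_{n-1})(0,1)$, $z_n=(y_{n-1},y_{n-1},x_{n-1})$ (these are the iterates, under the Markov model for a PCF cubic with combined critical orbit of length one, of the elements $(0,1,2)$, $(0,1)$, $\mathrm{id}$ carrying types $[s,3]$, $[n,2][s,1]$, $[n,1]^2[s,1]$ respectively). Let $L_0$ be trivial, $L_n=\langle x_n,z_n,L_{n-1}\rangle$ and $M_n=\langle x_n,y_n,z_n,L_{n-1}\rangle$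 (so $M_1=S_3$). -}

module Defs where

open import Data.Nat using (ℕ; zero; suc)
open import Data.Fin using (Fin; zero; suc)
open import Data.Product using (Σ; _×_; _,_)
open import Data.Sum using (_⊎_)
open import Relation.Binary.PropositionalEquality using (_≡_)
open import Relation.Nullary using (¬_)

data S3 : Set where
  e    : S3
  c    : S3
  c²   : S3
  t01  : S3
  t02  : S3
  t12  : S3

apply : S3 → Fin 3 → Fin 3
apply e   i = i
apply c   zero = suc zero
apply c   (suc zero) = suc (suc zero)
apply c   (suc (suc zero)) = zero
apply c²  zero = suc (suc zero)
apply c²  (suc zero) = zero
apply c²  (suc (suc zero)) = suc zero
apply t01 zero = suc zero
apply t01 (suc zero) = zero
apply t01 (suc (suc zero)) = suc (suc zero)
apply t02 zero = suc (suc zero)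
apply t02 (suc zero) = suc zero
apply t02 (suc (suc zero)) = zero
apply t12 zero = zero
apply t12 (suc zero) = suc (suc zero)
apply t12 (suc (suc zero)) = suc zero

-- a permutation of {0,1,2} is determined by the images of 0 and 1
fromImg : Fin 3 → Fin 3 → S3
fromImg zero (suc zero) = e
fromImg zero (suc (suc zero)) = t12
fromImg (suc zero) zero = t01
fromImg (suc zero) (suc (suc zero)) = c
fromImg (suc (suc zero)) zero = c²
fromImg (suc (suc zero)) (suc zero) = t02
fromImg _ _ = e   -- never reached for genuine permutations

-- composition, "first p, then q":  apply (p ⊙ q) i = apply q (apply p i)
_⊙_ : S3 → S3 → S3
p ⊙ q = fromImg (apply q (apply p zero)) (apply q (apply p (suc zero)))

invS3 : S3 → S3
invS3 e = e
invS3 c = c²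
invS3 c² = c
invS3 t01 = t01
invS3 t02 = t02
invS3 t12 = t12

-- Aut(𝒯ₙ): automorphisms of the 3-ary tree truncated at level n.
-- node σ₀ σ₁ σ₂ π  is the element (σ₀,σ₁,σ₂)π : it maps the vertex  x w
-- to  π(x) σₓ(w),  i.e. σₓ is the section at the first-level vertex x
-- and π is the action on the first level.

data Aut : ℕ → Set where
  leaf : Aut zero
  node : {n : ℕ} → Aut n → Aut n → Aut n → S3 → Aut (suc n)

idA : (n : ℕ) → Aut n
idA zero = leaf
idA (suc n) = node (idA n) (idA n) (idA n) e

sec : {n : ℕ} → Aut (suc n) → Fin 3 → Aut n
sec (node s₀ s₁ s₂ π) zero = s₀
sec (node s₀ s₁ s₂ π) (suc zero) = s₁
sec (node s₀ s₁ s₂ π) (suc (suc zero)) = s₂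

perm : {n : ℕ} → Aut (suc n) → S3
perm (node _ _ _ π) = π

-- product g · h = "first g, then h" (right action on the tree):
-- section at x is  σₓ · τ_{π(x)},  level-one permutation  π ⊙ ρ.
infixl 7 _·_
_·_ : {n : ℕ} → Aut n → Aut n → Aut n
leaf · leaf = leaf
_·_ {suc n} g h =
  node (sec g zero · sec h (apply (perm g) zero))
       (sec g (suc zero) · sec h (apply (perm g) (suc zero)))
       (sec g (suc (suc zero)) · sec h (apply (perm g) (suc (suc zero))))
       (perm g ⊙ perm h)

_⁻¹ : {n : ℕ} → Aut n → Aut n
leaf ⁻¹ = leaf
_⁻¹ {suc n} g =
  node (sec g (apply (invS3 (perm g)) zero) ⁻¹)
       (sec g (apply (invS3 (perm g)) (suc zero)) ⁻¹)
       (sec g (apply (invS3 (perm g)) (suc (suc zero))) ⁻¹)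
       (invS3 (perm g))

ι : {n : ℕ} → Aut n → Aut (suc n)
ι {n} σ = node σ (idA n) (idA n) e

data ⟨_⟩ {n : ℕ} (S : Aut n → Set) : Aut n → Set where
  gen : {g : Aut n} → S g → ⟨ S ⟩ g
  one : ⟨ S ⟩ (idA n)
  mul : {g h : Aut n} → ⟨ S ⟩ g → ⟨ S ⟩ h → ⟨ S ⟩ (g · h)
  inv : {g : Aut n} → ⟨ S ⟩ g → ⟨ S ⟩ (g ⁻¹)

-- With x₀ = y₀ = leaf, the uniform recursion
-- below gives exactly x₁ = (0,1,2), y₁ = (0,1), z₁ = id on level 1, and
-- for n ≥ 2:  xₙ = (id,id,xₙ₋₁)(0,1,2),  yₙ = (id,yₙ₋₁,xₙ₋₁)(0,1),
-- zₙ = (yₙ₋₁,yₙ₋₁,xₙ₋₁).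

xA : (n : ℕ) → Aut n
xA zero = leaf
xA (suc n) = node (idA n) (idA n) (xA n) c

yA : (n : ℕ) → Aut n
yA zero = leaf
yA (suc n) = node (idA n) (yA n) (xA n) t01

zA : (n : ℕ) → Aut n
zA zero = leaf
zA (suc n) = node (yA n) (yA n) (xA n) e

L : (n : ℕ) → Aut n → Set
L zero g = g ≡ idA zero
L (suc n) = ⟨ (λ g → g ≡ xA (suc n) ⊎ g ≡ zA (suc n)
                    ⊎ Σ (Aut n) (λ h → L n h × g ≡ ι h)) ⟩

M : (n : ℕ) → Aut (suc n) → Set   -- M n denotes M_{n+1}
M n = ⟨ (λ g → g ≡ xA (suc n) ⊎ g ≡ yA (suc n) ⊎ g ≡ zA (suc n)
             ⊎ Σ (Aut n) (λ h → L n h × g ≡ ι h)) ⟩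

_⊆_ : {n : ℕ} → (Aut n → Set) → (Aut n → Set) → Set
H ⊆ G = ∀ g → H g → G g

IsNormalIn : {n : ℕ} → (Aut n → Set) → (Aut n → Set) → Set
IsNormalIn H G = ∀ g h → G g → H h → H (g · h · g ⁻¹)

-- [G : H] = 2 : there are exactly two left cosets of H in G, namely
-- H itself and a second coset aH with a ∈ G ∖ H, and every m ∈ G lies in
-- one of them (m ∈ aH  ⟺  a⁻¹m ∈ H).
Index2 : {n : ℕ} → (Aut n → Set) → (Aut n → Set) → Set
Index2 {n} H G =
  Σ (Aut n) (λ a → G a × ¬ H a × (∀ m → G m → H m ⊎ H (a ⁻¹ · m)))

{-# OPTIONS --safe #-}
module Submission where

open import Defs
open import Algebra.Bundles using (Group; CommutativeRing)
open import Algebra.Structures using (IsGroup)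
import Algebra.Properties.CommutativeMonoid.Sum as CommutativeMonoidSum
import Algebra.Properties.Group as GroupProperties
open import Data.Bool using (Bool; true; false; _xor_)
import Data.Bool.Properties as Bool
open import Data.Fin using (zero; suc)
import Data.Fin.Properties as Fin
open import Data.Fin.Permutation using (Permutation; permutation)
open import Data.Nat using (ℕ; zero; suc)
open import Data.Product using (_×_; _,_; proj₁; proj₂)
open import Data.Sum using (_⊎_; inj₁; inj₂)
import Data.Sum as Sum
open import Data.Unit using (⊤; tt)
open import Level using (0ℓ)
open import Relation.Nullary using (Dec; ¬_)
open import Relation.Nullary.Decidable using (map′; _×-dec_; toWitness)
open import Relation.Binary.PropositionalEquality
  using (_≡_; refl; sym; trans; cong; cong₂; subst; module ≡-Reasoning)
open import Relation.Binary.PropositionalEquality.Algebra using (isMagma)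

open CommutativeRing Bool.xor-∧-commutativeRing using (+-commutativeMonoid; +-abelianGroup)
open CommutativeMonoidSum +-commutativeMonoid
  using (sum-syntax; sum-cong-≗; ∑-distrib-+; ∑-permute)
open import Algebra.Properties.AbelianGroup +-abelianGroup using (xyx⁻¹≈y)

-- Call g ∈ Aut(𝒯ₙ₊₁) coherent if at every vertex above level n the sign of the local
-- permutation is the sum (mod 2) of the signs at its three children.  Multiplication only
-- permutes and adds the children's signs, so the coherent elements form a subgroup; it
-- contains x, y, z and ι(Lₙ), hence Mₙ₊₁, and on it the root sign is a homomorphism that is
-- even on the generators of Lₙ₊₁ and odd on y.  Conversely every coherent element with even
-- root sign lies in Lₙ₊₁, by induction on n: multiplying by a power of x makes the root
-- permutation trivial; an element (a,b,d) with even sections is a product of ι(Lₙ) and its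
-- conjugates by x, which cycle the sections; otherwise, by coherence, exactly two sections
-- are odd, and multiplying by z = (y,y,x) after a suitable x-conjugation makes them even.
-- So Lₙ₊₁ is the even part of a group containing Mₙ₊₁ and y, and the claims follow.

∀S3? : {P : S3 → Set} → (∀ p → Dec (P p)) → Dec (∀ p → P p)
∀S3? P? = map′ (λ (pe , pc , pc² , p01 , p02 , p12) →
                  λ { e → pe ; c → pc ; c² → pc² ; t01 → p01 ; t02 → p02 ; t12 → p12 })
               (λ ∀P → ∀P e , ∀P c , ∀P c² , ∀P t01 , ∀P t02 , ∀P t12)
               (P? e ×-dec P? c ×-dec P? c² ×-dec P? t01 ×-dec P? t02 ×-dec P? t12)

sgn : S3 → Bool
sgn e   = false
sgn c   = false
sgn c²  = false
sgn t01 = true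
sgn t02 = true
sgn t12 = true

apply-⊙ : ∀ p q i → apply (p ⊙ q) i ≡ apply q (apply p i)
apply-⊙ = toWitness {a? = ∀S3? λ p → ∀S3? λ q → Fin.all? λ i →
                           apply (p ⊙ q) i Fin.≟ apply q (apply p i)} _

apply-invS3ˡ : ∀ p i → apply (invS3 p) (apply p i) ≡ i
apply-invS3ˡ = toWitness {a? = ∀S3? λ p → Fin.all? λ i → apply (invS3 p) (apply p i) Fin.≟ i} _

apply-invS3ʳ : ∀ p i → apply p (apply (invS3 p) i) ≡ i
apply-invS3ʳ = toWitness {a? = ∀S3? λ p → Fin.all? λ i → apply p (apply (invS3 p) i) Fin.≟ i} _

sgn-⊙ : ∀ p q → sgn (p ⊙ q) ≡ sgn p xor sgn q
sgn-⊙ = toWitness {a? = ∀S3? λ p → ∀S3? λ q → sgn (p ⊙ q) Bool.≟ sgn p xor sgn q} _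

sgn-invS3 : ∀ p → sgn (invS3 p) ≡ sgn p
sgn-invS3 = toWitness {a? = ∀S3? λ p → sgn (invS3 p) Bool.≟ sgn p} _

fromImg-apply : ∀ p → fromImg (apply p zero) (apply p (suc zero)) ≡ p
fromImg-apply e   = refl
fromImg-apply c   = refl
fromImg-apply c²  = refl
fromImg-apply t01 = refl
fromImg-apply t02 = refl
fromImg-apply t12 = refl

S3-ext : ∀ {p q} → (∀ i → apply p i ≡ apply q i) → p ≡ q
S3-ext {p} {q} p≗q = begin
  p                                           ≡⟨ fromImg-apply p ⟨
  fromImg (apply p zero) (apply p (suc zero)) ≡⟨ cong₂ fromImg (p≗q zero) (p≗q (suc zero)) ⟩
  fromImg (apply q zero) (apply q (suc zero)) ≡⟨ fromImg-apply q ⟩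
  q                                           ∎
  where open ≡-Reasoning

⊙-assoc : ∀ p q r → (p ⊙ q) ⊙ r ≡ p ⊙ (q ⊙ r)
⊙-assoc p q r = S3-ext λ i → begin
  apply ((p ⊙ q) ⊙ r) i           ≡⟨ apply-⊙ (p ⊙ q) r i ⟩
  apply r (apply (p ⊙ q) i)       ≡⟨ cong (apply r) (apply-⊙ p q i) ⟩
  apply r (apply q (apply p i))   ≡⟨ apply-⊙ q r (apply p i) ⟨
  apply (q ⊙ r) (apply p i)       ≡⟨ apply-⊙ p (q ⊙ r) i ⟨
  apply (p ⊙ (q ⊙ r)) i           ∎
  where open ≡-Reasoning

⊙-identityˡ : ∀ p → e ⊙ p ≡ p
⊙-identityˡ = fromImg-apply

⊙-identityʳ : ∀ p → p ⊙ e ≡ p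
⊙-identityʳ = fromImg-apply

⊙-inverseˡ : ∀ p → invS3 p ⊙ p ≡ e
⊙-inverseˡ p = S3-ext λ i → trans (apply-⊙ (invS3 p) p i) (apply-invS3ʳ p i)

⊙-inverseʳ : ∀ p → p ⊙ invS3 p ≡ e
⊙-inverseʳ p = S3-ext λ i → trans (apply-⊙ p (invS3 p) i) (apply-invS3ˡ p i)

toPermutation : S3 → Permutation 3 3
toPermutation p = permutation (apply p) (apply (invS3 p)) (apply-invS3ʳ p) (apply-invS3ˡ p)

-- Aut(𝒯ₙ) as a group

node-cong : ∀ {n} {a a′ b b′ d d′ : Aut n} {p p′ : S3} →
            a ≡ a′ → b ≡ b′ → d ≡ d′ → p ≡ p′ → node a b d p ≡ node a′ b′ d′ p′
node-cong refl refl refl refl = refl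

Aut-ext : ∀ {n} {g h : Aut (suc n)} →
          (∀ i → sec g i ≡ sec h i) → perm g ≡ perm h → g ≡ h
Aut-ext {g = node _ _ _ _} {node _ _ _ _} s p =
  node-cong (s zero) (s (suc zero)) (s (suc (suc zero))) p

sec-· : ∀ {n} (g h : Aut (suc n)) i → sec (g · h) i ≡ sec g i · sec h (apply (perm g) i)
sec-· (node _ _ _ _) h zero             = refl
sec-· (node _ _ _ _) h (suc zero)       = refl
sec-· (node _ _ _ _) h (suc (suc zero)) = refl

sec-⁻¹ : ∀ {n} (g : Aut (suc n)) i → sec (g ⁻¹) i ≡ sec g (apply (invS3 (perm g)) i) ⁻¹
sec-⁻¹ (node _ _ _ _) zero             = refl
sec-⁻¹ (node _ _ _ _) (suc zero)       = refl
sec-⁻¹ (node _ _ _ _) (suc (suc zero)) = refl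

sec-idA : ∀ {n} i → sec (idA (suc n)) i ≡ idA n
sec-idA zero             = refl
sec-idA (suc zero)       = refl
sec-idA (suc (suc zero)) = refl

·-identityˡ : ∀ {n} (g : Aut n) → idA n · g ≡ g
·-identityˡ leaf = refl
·-identityˡ (node a b d p) =
  node-cong (·-identityˡ a) (·-identityˡ b) (·-identityˡ d) (⊙-identityˡ p)

·-identityʳ : ∀ {n} (g : Aut n) → g · idA n ≡ g
·-identityʳ leaf = refl
·-identityʳ g@(node _ _ _ p) = Aut-ext (λ i → begin
  sec (g · idA _) i                    ≡⟨ sec-· g (idA _) i ⟩
  sec g i · sec (idA _) (apply p i)    ≡⟨ cong (sec g i ·_) (sec-idA (apply p i)) ⟩
  sec g i · idA _                      ≡⟨ ·-identityʳ (sec g i) ⟩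
  sec g i                              ∎) (⊙-identityʳ p)
  where open ≡-Reasoning

·-assoc : ∀ {n} (g h k : Aut n) → (g · h) · k ≡ g · (h · k)
·-assoc leaf leaf leaf = refl
·-assoc g@(node _ _ _ p) h@(node _ _ _ q) k = Aut-ext (λ i → begin
  sec ((g · h) · k) i                                           ≡⟨ sec-· (g · h) k i ⟩
  sec (g · h) i · sec k (apply (p ⊙ q) i)
    ≡⟨ cong₂ (λ s j → s · sec k j) (sec-· g h i) (apply-⊙ p q i) ⟩
  (sec g i · sec h (apply p i)) · sec k (apply q (apply p i))   ≡⟨ ·-assoc _ _ _ ⟩
  sec g i · (sec h (apply p i) · sec k (apply q (apply p i)))
    ≡⟨ cong (sec g i ·_) (sec-· h k (apply p i)) ⟨
  sec g i · sec (h · k) (apply p i)                             ≡⟨ sec-· g (h · k) i ⟨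
  sec (g · (h · k)) i                                           ∎) (⊙-assoc p q (perm k))
  where open ≡-Reasoning

·-inverseˡ : ∀ {n} (g : Aut n) → g ⁻¹ · g ≡ idA n
·-inverseˡ leaf = refl
·-inverseˡ (node _ _ _ p) =
  node-cong (·-inverseˡ _) (·-inverseˡ _) (·-inverseˡ _) (⊙-inverseˡ p)

·-inverseʳ : ∀ {n} (g : Aut n) → g · g ⁻¹ ≡ idA n
·-inverseʳ leaf = refl
·-inverseʳ g@(node _ _ _ p) = Aut-ext (λ i → begin
  sec (g · g ⁻¹) i                                  ≡⟨ sec-· g (g ⁻¹) i ⟩
  sec g i · sec (g ⁻¹) (apply p i)                  ≡⟨ cong (sec g i ·_) (sec-⁻¹ g (apply p i)) ⟩
  sec g i · sec g (apply (invS3 p) (apply p i)) ⁻¹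
    ≡⟨ cong (λ j → sec g i · sec g j ⁻¹) (apply-invS3ˡ p i) ⟩
  sec g i · sec g i ⁻¹                              ≡⟨ ·-inverseʳ (sec g i) ⟩
  idA _                                             ≡⟨ sec-idA i ⟨
  sec (idA _) i                                     ∎) (⊙-inverseʳ p)
  where open ≡-Reasoning

Aut-isGroup : ∀ n → IsGroup _≡_ (_·_ {n}) (idA n) _⁻¹
Aut-isGroup n = record
  { isMonoid = record
    { isSemigroup = record { isMagma = isMagma _·_ ; assoc = ·-assoc }
    ; identity    = ·-identityˡ , ·-identityʳ
    }
  ; inverse = ·-inverseˡ , ·-inverseʳ
  ; ⁻¹-cong = cong _⁻¹
  }

Aut-group : ℕ → Group 0ℓ 0ℓ
Aut-group n = record { isGroup = Aut-isGroup n }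

module AutGroup {n : ℕ} = GroupProperties (Aut-group n)
open AutGroup using (ε⁻¹≈ε; \\-leftDividesˡ; //-rightDividesˡ; //-rightDividesʳ)

odd : ∀ {n} → Aut (suc n) → Bool
odd g = sgn (perm g)

odd-· : ∀ {n} (g h : Aut (suc n)) → odd (g · h) ≡ odd g xor odd h
odd-· (node _ _ _ p) (node _ _ _ q) = sgn-⊙ p q

odd-⁻¹ : ∀ {n} (g : Aut (suc n)) → odd (g ⁻¹) ≡ odd g
odd-⁻¹ (node _ _ _ p) = sgn-invS3 p

odd-conj : ∀ {n} (a g : Aut (suc n)) → odd (a · g · a ⁻¹) ≡ odd g
odd-conj a g = begin
  odd (a · g · a ⁻¹)              ≡⟨ odd-· (a · g) (a ⁻¹) ⟩
  odd (a · g) xor odd (a ⁻¹)      ≡⟨ cong₂ _xor_ (odd-· a g) (odd-⁻¹ a) ⟩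
  (odd a xor odd g) xor odd a     ≡⟨ xyx⁻¹≈y (odd a) (odd g) ⟩
  odd g                           ∎
  where open ≡-Reasoning

-- Subgroups and the root sign

record IsSubgroup {n : ℕ} (H : Aut n → Set) : Set where
  field
    idA-closed : H (idA n)
    ·-closed   : ∀ {g h} → H g → H h → H (g · h)
    ⁻¹-closed  : ∀ {g} → H g → H (g ⁻¹)

  conj-closed : ∀ {a g} → H a → H g → H (a · g · a ⁻¹)
  conj-closed Ha Hg = ·-closed (·-closed Ha Hg) (⁻¹-closed Ha)

  conj-reflects : ∀ {a g} → H a → H (a · g · a ⁻¹) → H g
  conj-reflects {a} {g} Ha Haga⁻¹ =
    subst H a⁻¹·aga⁻¹·a≡g (·-closed (·-closed (⁻¹-closed Ha) Haga⁻¹) Ha)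
    where
    open ≡-Reasoning
    a⁻¹·aga⁻¹·a≡g : a ⁻¹ · (a · g · a ⁻¹) · a ≡ g
    a⁻¹·aga⁻¹·a≡g = begin
      a ⁻¹ · (a · g · a ⁻¹) · a   ≡⟨ cong (_· a) (·-assoc (a ⁻¹) (a · g) (a ⁻¹)) ⟨
      a ⁻¹ · (a · g) · a ⁻¹ · a   ≡⟨ cong (λ s → s · a ⁻¹ · a) (·-assoc (a ⁻¹) a g) ⟨
      a ⁻¹ · a · g · a ⁻¹ · a     ≡⟨ cong (λ s → s · g · a ⁻¹ · a) (·-inverseˡ a) ⟩
      idA _ · g · a ⁻¹ · a        ≡⟨ cong (λ s → s · a ⁻¹ · a) (·-identityˡ g) ⟩
      g · a ⁻¹ · a                ≡⟨ //-rightDividesˡ a g ⟩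
      g                           ∎

open IsSubgroup

⟨⟩-isSubgroup : ∀ {n} (S : Aut n → Set) → IsSubgroup ⟨ S ⟩
⟨⟩-isSubgroup S = record { idA-closed = one ; ·-closed = mul ; ⁻¹-closed = inv }

⟨⟩-least : ∀ {n} {S H : Aut n → Set} → IsSubgroup H → S ⊆ H → ⟨ S ⟩ ⊆ H
⟨⟩-least H-sub S⊆H g (gen s)   = S⊆H g s
⟨⟩-least H-sub S⊆H _ one       = idA-closed H-sub
⟨⟩-least H-sub S⊆H _ (mul p q) =
  ·-closed H-sub (⟨⟩-least H-sub S⊆H _ p) (⟨⟩-least H-sub S⊆H _ q)
⟨⟩-least H-sub S⊆H _ (inv p)   = ⁻¹-closed H-sub (⟨⟩-least H-sub S⊆H _ p)

⟨⟩-mono : ∀ {n} {S T : Aut n → Set} → S ⊆ T → ⟨ S ⟩ ⊆ ⟨ T ⟩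
⟨⟩-mono {T = T} S⊆T = ⟨⟩-least (⟨⟩-isSubgroup T) (λ g s → gen (S⊆T g s))

Signed : ∀ {n} → (Aut (suc n) → Set) → Bool → Aut (suc n) → Set
Signed G s g = G g × odd g ≡ s

Even : ∀ {n} → (Aut (suc n) → Set) → Aut (suc n) → Set
Even G = Signed G false

module _ {n} {G : Aut (suc n) → Set} (G-sub : IsSubgroup G) where

  Even-isSubgroup : IsSubgroup (Even G)
  Even-isSubgroup = record
    { idA-closed = idA-closed G-sub , refl
    ; ·-closed   = λ {g} {h} (Gg , og) (Gh , oh) →
                     ·-closed G-sub Gg Gh , trans (odd-· g h) (cong₂ _xor_ og oh)
    ; ⁻¹-closed  = λ {g} (Gg , og) → ⁻¹-closed G-sub Gg , trans (odd-⁻¹ g) og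
    }

  Signed-conj : ∀ {a g s} → G a → Signed G s g → Signed G s (a · g · a ⁻¹)
  Signed-conj {a} {g} Ga (Gg , og) = conj-closed G-sub Ga Gg , trans (odd-conj a g) og

  Even-normal : IsNormalIn (Even G) G
  Even-normal _ _ = Signed-conj

  odd⁻¹·odd-even : ∀ {a m} → Signed G true a → Signed G true m → Even G (a ⁻¹ · m)
  odd⁻¹·odd-even {a} {m} (Ga , oa) (Gm , om) =
    ·-closed G-sub (⁻¹-closed G-sub Ga) Gm ,
    trans (odd-· (a ⁻¹) m) (cong₂ _xor_ (trans (odd-⁻¹ a) oa) om)

  Even-cover : ∀ {a m} → Signed G true a → G m → Even G m ⊎ Even G (a ⁻¹ · m)
  Even-cover {m = m} Oa Gm with odd m in om
  ... | false = inj₁ (Gm , refl)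
  ... | true  = inj₂ (odd⁻¹·odd-even Oa (Gm , om))

-- Coherent automorphisms

Σodd : ∀ {n} → Aut (suc (suc n)) → Bool
Σodd g = ∑[ i < 3 ] odd (sec g i)

Coherent : (n : ℕ) → Aut (suc n) → Set
Coherent zero    g = ⊤
Coherent (suc n) g = (∀ i → Coherent n (sec g i)) × Σodd g ≡ odd g

EvenCoherent : (n : ℕ) → Aut (suc n) → Set
EvenCoherent n = Even (Coherent n)

coherent-node : ∀ {n a b d p} → Coherent n a → Coherent n b → Coherent n d →
                odd a xor (odd b xor (odd d xor false)) ≡ sgn p →
                Coherent (suc n) (node a b d p)
coherent-node ca cb cd parity =
  (λ { zero → ca ; (suc zero) → cb ; (suc (suc zero)) → cd }) , parity

Σodd-permute : ∀ {n} (g : Aut (suc (suc n))) p →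
               ∑[ i < 3 ] odd (sec g (apply p i)) ≡ Σodd g
Σodd-permute g p = sym (∑-permute (λ i → odd (sec g i)) (toPermutation p))

coherent-idA : ∀ n → Coherent n (idA (suc n))
coherent-idA zero    = tt
coherent-idA (suc n) = coherent-node (coherent-idA n) (coherent-idA n) (coherent-idA n) refl

coherent-· : ∀ n {g h} → Coherent n g → Coherent n h → Coherent n (g · h)
coherent-· zero _ _ = tt
coherent-· (suc n) {g@(node _ _ _ p)} {h} (cg , Σg) (ch , Σh) =
  (λ i → subst (Coherent n) (sym (sec-· g h i)) (coherent-· n (cg i) (ch (apply p i)))) ,
  parity
  where
  open ≡-Reasoning
  parity : Σodd (g · h) ≡ odd (g · h)
  parity = begin
    ∑[ i < 3 ] odd (sec (g · h) i)
      ≡⟨ sum-cong-≗ (λ i → trans (cong odd (sec-· g h i))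
                                 (odd-· (sec g i) (sec h (apply p i)))) ⟩
    ∑[ i < 3 ] (odd (sec g i) xor odd (sec h (apply p i)))
      ≡⟨ ∑-distrib-+ (λ i → odd (sec g i)) (λ i → odd (sec h (apply p i))) ⟩
    Σodd g xor ∑[ i < 3 ] odd (sec h (apply p i))
      ≡⟨ cong₂ _xor_ Σg (trans (Σodd-permute h p) Σh) ⟩
    odd g xor odd h                                ≡⟨ odd-· g h ⟨
    odd (g · h)                                    ∎

coherent-⁻¹ : ∀ n {g} → Coherent n g → Coherent n (g ⁻¹)
coherent-⁻¹ zero _ = tt
coherent-⁻¹ (suc n) {g@(node _ _ _ p)} (cg , Σg) =
  (λ i → subst (Coherent n) (sym (sec-⁻¹ g i)) (coherent-⁻¹ n (cg (apply (invS3 p) i)))) ,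
  parity
  where
  open ≡-Reasoning
  parity : Σodd (g ⁻¹) ≡ odd (g ⁻¹)
  parity = begin
    ∑[ i < 3 ] odd (sec (g ⁻¹) i)
      ≡⟨ sum-cong-≗ (λ i → trans (cong odd (sec-⁻¹ g i))
                                 (odd-⁻¹ (sec g (apply (invS3 p) i)))) ⟩
    ∑[ i < 3 ] odd (sec g (apply (invS3 p) i))     ≡⟨ Σodd-permute g (invS3 p) ⟩
    Σodd g                                         ≡⟨ Σg ⟩
    odd g                                          ≡⟨ odd-⁻¹ g ⟨
    odd (g ⁻¹)                                     ∎

coherent-isSubgroup : ∀ n → IsSubgroup (Coherent n)
coherent-isSubgroup n = record
  { idA-closed = coherent-idA n ; ·-closed = coherent-· n ; ⁻¹-closed = coherent-⁻¹ n }

evenCoherent-isSubgroup : ∀ n → IsSubgroup (EvenCoherent n)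
evenCoherent-isSubgroup n = Even-isSubgroup (coherent-isSubgroup n)

evenCoherent-x : ∀ n → EvenCoherent n (xA (suc n))
evenCoherent-x zero    = tt , refl
evenCoherent-x (suc n) =
  coherent-node (coherent-idA n) (coherent-idA n) (proj₁ (evenCoherent-x n)) refl , refl

coherent-y : ∀ n → Coherent n (yA (suc n))
coherent-y zero    = tt
coherent-y (suc n) = coherent-node (coherent-idA n) (coherent-y n) (proj₁ (evenCoherent-x n)) refl

evenCoherent-z : ∀ n → EvenCoherent n (zA (suc n))
evenCoherent-z zero    = tt , refl
evenCoherent-z (suc n) =
  coherent-node (coherent-y n) (coherent-y n) (proj₁ (evenCoherent-x n)) refl , refl

evenCoherent-ι : ∀ n {h} → EvenCoherent n h → EvenCoherent (suc n) (ι h)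
evenCoherent-ι n (ch , oh) =
  coherent-node ch (coherent-idA n) (coherent-idA n) (cong (_xor false) oh) , refl

mutual
  L⊆evenCoherent : ∀ n → L (suc n) ⊆ EvenCoherent n
  L⊆evenCoherent n = ⟨⟩-least (evenCoherent-isSubgroup n) λ
    { _ (inj₁ refl)                    → evenCoherent-x n
    ; _ (inj₂ (inj₁ refl))             → evenCoherent-z n
    ; _ (inj₂ (inj₂ (h , Lh , refl))) → ι-L⊆evenCoherent n Lh
    }

  ι-L⊆evenCoherent : ∀ n {h} → L n h → EvenCoherent n (ι h)
  ι-L⊆evenCoherent zero    refl = tt , refl
  ι-L⊆evenCoherent (suc n) Lh   = evenCoherent-ι n (L⊆evenCoherent n _ Lh)

M⊆coherent : ∀ n → M n ⊆ Coherent n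
M⊆coherent n = ⟨⟩-least (coherent-isSubgroup n) λ
  { _ (inj₁ refl)                           → proj₁ (evenCoherent-x n)
  ; _ (inj₂ (inj₁ refl))                    → coherent-y n
  ; _ (inj₂ (inj₂ (inj₁ refl)))             → proj₁ (evenCoherent-z n)
  ; _ (inj₂ (inj₂ (inj₂ (h , Lh , refl)))) → proj₁ (ι-L⊆evenCoherent n Lh)
  }

-- Even coherent elements lie in Lₙ₊₁

module StabilizerStep (k : ℕ) (ih : EvenCoherent k ⊆ L (suc k)) where

  private
    Λ : Aut (suc (suc k)) → Set
    Λ = L (suc (suc k))

    X : Aut (suc (suc k))
    X = xA (suc (suc k))

    x y 1ₖ : Aut (suc k)
    x  = xA (suc k)
    y  = yA (suc k)
    1ₖ = idA (suc k)

    Λ-sub : IsSubgroup Λ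
    Λ-sub = ⟨⟩-isSubgroup _

    C-sub : IsSubgroup (Coherent k)
    C-sub = coherent-isSubgroup k

    E-sub : IsSubgroup (EvenCoherent k)
    E-sub = evenCoherent-isSubgroup k

    Ex : EvenCoherent k x
    Ex = evenCoherent-x k

  conj-X : ∀ a b d → X · node a b d e · X ⁻¹ ≡ node b d (x · a · x ⁻¹) e
  conj-X a b d = node-cong (conj-1ₖ b) (conj-1ₖ d) refl refl
    where
    conj-1ₖ : ∀ t → 1ₖ · t · 1ₖ ⁻¹ ≡ t
    conj-1ₖ t = trans (cong₂ _·_ (·-identityˡ t) ε⁻¹≈ε) (·-identityʳ t)

  rotate : ∀ {a b d} → Λ (node b d (x · a · x ⁻¹) e) → Λ (node a b d e)
  rotate {a} {b} {d} h =
    conj-reflects Λ-sub (gen (inj₁ refl)) (subst Λ (sym (conj-X a b d)) h)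

  shift : ∀ {b d} → Λ (node b d 1ₖ e) → Λ (node 1ₖ b d e)
  shift {b} {d} h = rotate (subst (λ t → Λ (node b d t e)) (sym x·1ₖ·x⁻¹≡1ₖ) h)
    where
    x·1ₖ·x⁻¹≡1ₖ : x · 1ₖ · x ⁻¹ ≡ 1ₖ
    x·1ₖ·x⁻¹≡1ₖ = trans (cong (_· x ⁻¹) (·-identityʳ x)) (·-inverseʳ x)

  L³⊆Λ : ∀ {a b d} → L (suc k) a → L (suc k) b → L (suc k) d → Λ (node a b d e)
  L³⊆Λ {a} {b} {d} La Lb Ld =
    subst Λ product≡ (mul (mul (ι∈Λ La) (shift (ι∈Λ Lb))) (shift (shift (ι∈Λ Ld))))
    where
    ι∈Λ : ∀ {t} → L (suc k) t → Λ (node t 1ₖ 1ₖ e)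
    ι∈Λ {t} Lt = gen (inj₂ (inj₂ (t , Lt , refl)))
    product≡ : node a 1ₖ 1ₖ e · node 1ₖ b 1ₖ e · node 1ₖ 1ₖ d e ≡ node a b d e
    product≡ = node-cong (trans (·-identityʳ (a · 1ₖ)) (·-identityʳ a))
                         (trans (·-identityʳ (1ₖ · b)) (·-identityˡ b))
                         (trans (cong (_· d) (·-identityˡ 1ₖ)) (·-identityˡ d)) refl

  even-even-even : ∀ {a b d} → EvenCoherent k a → EvenCoherent k b → EvenCoherent k d →
                   Λ (node a b d e)
  even-even-even Ea Eb Ed = L³⊆Λ (ih _ Ea) (ih _ Eb) (ih _ Ed)

  odd-odd-even : ∀ {a b d} → Signed (Coherent k) true a → Signed (Coherent k) true b →
                 EvenCoherent k d → Λ (node a b d e)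
  odd-odd-even {a} {b} {d} Oa Ob Ed =
    subst Λ (node-cong (\\-leftDividesˡ y a) (\\-leftDividesˡ y b) (\\-leftDividesˡ x d) refl)
      (mul (gen (inj₂ (inj₁ refl)))
           (even-even-even (odd⁻¹·odd-even C-sub Oy Oa) (odd⁻¹·odd-even C-sub Oy Ob)
                           (·-closed E-sub (⁻¹-closed E-sub Ex) Ed)))
    where
    Oy : Signed (Coherent k) true y
    Oy = coherent-y k , refl

  even-odd-odd : ∀ {a b d} → EvenCoherent k a → Signed (Coherent k) true b →
                 Signed (Coherent k) true d → Λ (node a b d e)
  even-odd-odd Ea Ob Od = rotate (odd-odd-even Ob Od (Signed-conj C-sub (proj₁ Ex) Ea))

  odd-even-odd : ∀ {a b d} → Signed (Coherent k) true a → EvenCoherent k b →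
                 Signed (Coherent k) true d → Λ (node a b d e)
  odd-even-odd Oa Eb Od = rotate (even-odd-odd Eb Od (Signed-conj C-sub (proj₁ Ex) Oa))

  bySign : ∀ {a b d} sa sb sd →
           Signed (Coherent k) sa a → Signed (Coherent k) sb b → Signed (Coherent k) sd d →
           sa xor (sb xor (sd xor false)) ≡ false → Λ (node a b d e)
  bySign false false false A B D _ = even-even-even A B D
  bySign true  true  false A B D _ = odd-odd-even A B D
  bySign true  false true  A B D _ = odd-even-odd A B D
  bySign false true  true  A B D _ = even-odd-odd A B D
  bySign true  true  true  _ _ _ ()
  bySign true  false false _ _ _ ()
  bySign false true  false _ _ _ ()
  bySign false false true  _ _ _ ()

  stabilizer⊆Λ : ∀ {a b d} → Coherent (suc k) (node a b d e) → Λ (node a b d e)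
  stabilizer⊆Λ (cs , parity) =
    bySign _ _ _ (cs zero , refl) (cs (suc zero) , refl) (cs (suc (suc zero)) , refl) parity

mutual
  evenCoherent⊆L : ∀ n → EvenCoherent n ⊆ L (suc n)
  evenCoherent⊆L n (node _ _ _ e) (cg , _) = stabilizer⊆L n cg
  evenCoherent⊆L n g@(node _ _ _ c) Eg =
    subst (L (suc n)) (//-rightDividesˡ (xA (suc n)) g)
      (mul (stabilizer⊆L n (proj₁ Eg·x⁻¹)) (gen (inj₁ refl)))
    where
    E-sub : IsSubgroup (EvenCoherent n)
    E-sub = evenCoherent-isSubgroup n
    Eg·x⁻¹ : EvenCoherent n (g · xA (suc n) ⁻¹)
    Eg·x⁻¹ = ·-closed E-sub Eg (⁻¹-closed E-sub (evenCoherent-x n))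
  evenCoherent⊆L n g@(node _ _ _ c²) Eg =
    subst (L (suc n)) (//-rightDividesʳ (xA (suc n)) g)
      (mul (stabilizer⊆L n (proj₁ Eg·x)) (inv (gen (inj₁ refl))))
    where
    Eg·x : EvenCoherent n (g · xA (suc n))
    Eg·x = ·-closed (evenCoherent-isSubgroup n) Eg (evenCoherent-x n)
  evenCoherent⊆L n (node _ _ _ t01) (_ , ())
  evenCoherent⊆L n (node _ _ _ t02) (_ , ())
  evenCoherent⊆L n (node _ _ _ t12) (_ , ())

  stabilizer⊆L : ∀ n {a b d} → Coherent n (node a b d e) → L (suc n) (node a b d e)
  stabilizer⊆L zero    {leaf} {leaf} {leaf} _ = one
  stabilizer⊆L (suc k) = StabilizerStep.stabilizer⊆Λ k (evenCoherent⊆L k)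

theorem3p7 : (n : ℕ) →
    (L (suc n) ⊆ M n) × IsNormalIn (L (suc n)) (M n) × Index2 (L (suc n)) (M n)
theorem3p7 n = L⊆M , normal , yA (suc n) , y∈M , y∉L , cover
  where
  L⊆M : L (suc n) ⊆ M n
  L⊆M = ⟨⟩-mono (λ _ → Sum.map₂ inj₂)

  normal : IsNormalIn (L (suc n)) (M n)
  normal g h Mg Lh = evenCoherent⊆L n _
    (Even-normal (coherent-isSubgroup n) g h (M⊆coherent n g Mg) (L⊆evenCoherent n h Lh))

  y∈M : M n (yA (suc n))
  y∈M = gen (inj₂ (inj₁ refl))

  y∉L : ¬ L (suc n) (yA (suc n))
  y∉L Ly with () ← proj₂ (L⊆evenCoherent n _ Ly)

  cover : ∀ m → M n m → L (suc n) m ⊎ L (suc n) (yA (suc n) ⁻¹ · m)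
  cover m Mm = Sum.map (evenCoherent⊆L n _) (evenCoherent⊆L n _)
    (Even-cover (coherent-isSubgroup n) (coherent-y n , refl) (M⊆coherent n m Mm))
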